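{- Let $G$ be an Abelian group and let $A\subset G$ be a Sidon set. Then $A$ is $3$-stable.
   Context: A set $A\subset G$ is a Sidon set if whenever $x-y=z-w$ for some $(x,y,z,w)\in A^4$ we have $x=y$ or $x=z$. For $k\in\mathbb{N}$, a set $A\subset G$ has the $k$-order property if there are vectors $a,b\in G^k$ such that for all $1\le i,j\le k$, $a_i+b_j\in A$ if and only if $i\le j$; if $A$ does not have the $k$-order property it is called $k$-stable. -}

module Defs where

open import Level using (Level; _⊔_; suc)
open import Algebra.Bundles using (AbelianGroup)
open import Data.Nat using (ℕ)
open import Data.Fin using (Fin; _≤_)
open import Data.Sum using (_⊎_)
open import Data.Product using (∃₂)
open import Function.Bundles using (_⇔_)
open import Relation.Nullary using (¬_)
open import Relation.Unary using (Pred)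

module _ {c ℓ : Level} (G : AbelianGroup c ℓ) where
  open AbelianGroup G

  -- A subset of G, as a predicate on the carrier; subsets of a setoid
  -- carrier are required to respect the setoid equality.
  RespectsEq : {p : Level} → Pred Carrier p → Set (c ⊔ ℓ ⊔ p)
  RespectsEq A = ∀ {x y} → x ≈ y → A x → A y

  IsSidon : {p : Level} → Pred Carrier p → Set (c ⊔ ℓ ⊔ p)
  IsSidon A = ∀ {x y z w} → A x → A y → A z → A w →
              x - y ≈ z - w → (x ≈ y) ⊎ (x ≈ z)

  HasOrderProperty : {p : Level} → ℕ → Pred Carrier p → Set (c ⊔ p)
  HasOrderProperty k A =
    ∃₂ λ (a b : Fin k → Carrier) →
      ∀ (i j : Fin k) → A (a i ∙ b j) ⇔ (i ≤ j)

  IsStable : {p : Level} → ℕ → Pred Carrier p → Set (c ⊔ p)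
  IsStable k A = ¬ HasOrderProperty k A

module Submission where

-- The key observation is that a Sidon set contains no nondegenerate
-- "rectangle": if u+v, u+w, u'+v, u'+w all lie in A then, since
-- (u+v) - (u+w) = v - w = (u'+v) - (u'+w), the Sidon property forces
-- u+v = u+w or u+v = u'+v, i.e. v = w or u = u' after cancellation.
--
-- Now suppose a, b ∈ G³ witness the 3-order property.  Since 0,1 ≤ 1,2,
-- the four sums a₀+b₁, a₀+b₂, a₁+b₁, a₁+b₂ lie in A, so b₁ = b₂ or
-- a₀ = a₁.  In the first case a₂+b₁ = a₂+b₂ ∈ A although 2 ≰ 1; in the
-- second a₁+b₀ = a₀+b₀ ∈ A although 1 ≰ 0.  Either way we contradict
-- the order property.

open import Defs
open import Level using (Level)
open import Algebra.Bundles using (AbelianGroup)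
open import Relation.Unary using (Pred)
open import Data.Fin using (Fin; zero; suc; _≤_)
open import Data.Nat using (z≤n; s≤s)
open import Data.Product using (_,_)
open import Data.Sum using (_⊎_; [_,_]′; map)
open import Data.Empty using (⊥)
open import Function.Bundles using (Equivalence)
import Algebra.Properties.AbelianGroup as AbelianGroupProperties
import Relation.Binary.Reasoning.Setoid as SetoidReasoning

module _ {c ℓ : Level} (G : AbelianGroup c ℓ) where
  open AbelianGroup G
  open AbelianGroupProperties G using (∙-cancelˡ; ∙-cancelʳ; ⁻¹-∙-comm)
  open SetoidReasoning setoid

  translate-difference : ∀ u v w → (u ∙ v) - (u ∙ w) ≈ v - w
  translate-difference u v w = begin
    (u ∙ v) ∙ (u ∙ w) ⁻¹       ≈⟨ ∙-cong (comm u v) (sym (⁻¹-∙-comm u w)) ⟩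
    (v ∙ u) ∙ (u ⁻¹ ∙ w ⁻¹)    ≈⟨ assoc v u _ ⟩
    v ∙ (u ∙ (u ⁻¹ ∙ w ⁻¹))    ≈⟨ ∙-congˡ (sym (assoc u (u ⁻¹) _)) ⟩
    v ∙ ((u ∙ u ⁻¹) ∙ w ⁻¹)    ≈⟨ ∙-congˡ (∙-congʳ (inverseʳ u)) ⟩
    v ∙ (ε ∙ w ⁻¹)             ≈⟨ ∙-congˡ (identityˡ _) ⟩
    v ∙ w ⁻¹                   ∎

  sidon-rectangle : {p : Level} {A : Pred Carrier p} → IsSidon G A →
    ∀ {u u' v w} → A (u ∙ v) → A (u ∙ w) → A (u' ∙ v) → A (u' ∙ w) →
    (v ≈ w) ⊎ (u ≈ u')
  sidon-rectangle sidon {u} {u'} {v} {w} uv uw u'v u'w =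
    map (∙-cancelˡ u v w) (∙-cancelʳ v u u')
        (sidon uv uw u'v u'w equalDifferences)
    where
    equalDifferences : (u ∙ v) - (u ∙ w) ≈ (u' ∙ v) - (u' ∙ w)
    equalDifferences =
      trans (translate-difference u v w) (sym (translate-difference u' v w))

lemma1p3 : {c ℓ p : Level} (G : AbelianGroup c ℓ) (A : Pred (AbelianGroup.Carrier G) p) →
    RespectsEq G A → IsSidon G A → IsStable G 3 A
lemma1p3 G A resp sidon (a , b , order) =
  [ columnsCollapse , rowsCollapse ]′
    (sidon-rectangle G sidon (inA 0₃ 1₃ z≤n)      (inA 0₃ 2₃ z≤n)
                             (inA 1₃ 1₃ (s≤s z≤n)) (inA 1₃ 2₃ (s≤s z≤n)))
  where
  open AbelianGroup G using (_≈_; _∙_; ∙-congˡ; ∙-congʳ; sym)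
  0₃ 1₃ 2₃ : Fin 3
  0₃ = zero
  1₃ = suc zero
  2₃ = suc (suc zero)

  inA : ∀ i j → i ≤ j → A (a i ∙ b j)
  inA i j = Equivalence.from (order i j)

  below : ∀ i j → A (a i ∙ b j) → i ≤ j
  below i j = Equivalence.to (order i j)

  columnsCollapse : b 1₃ ≈ b 2₃ → ⊥
  columnsCollapse b₁≈b₂ with below 2₃ 1₃ (resp (∙-congˡ (sym b₁≈b₂)) (inA 2₃ 2₃ (s≤s (s≤s z≤n))))
  ... | s≤s ()

  rowsCollapse : a 0₃ ≈ a 1₃ → ⊥
  rowsCollapse a₀≈a₁ with below 1₃ 0₃ (resp (∙-congʳ a₀≈a₁) (inA 0₃ 0₃ z≤n))
  ... | ()
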